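{- Let $T$ be a tree. If $\Gamma(T)-\gamma(T)<3$, then the domination polynomial $D(T,x)$ is unimodal.
   Context: A dominating set of a graph $G=(V,E)$ is a set $S\subseteq V$ such that every vertex is in $S$ or adjacent to a vertex of $S$; it is minimal if no proper subset is dominating. $\gamma(G)$ is the minimum size of a dominating set and $\Gamma(G)$ the maximum size of a minimal dominating set. If $d_i$ is the number of dominating sets of size $i$ and $n=|V|$, then $D(G,x)=\sum_{i=0}^n d_ix^i$. A polynomial $a_0+\cdots+a_nx^n$ is unimodal if there is $0\le k\le n$ with $a_0\le\cdots\le a_k\ge a_{k+1}\ge\cdots\ge a_n$. -}

module Defs where

open import Data.Nat using (ℕ; zero; suc; _≤_; _<_; _+_)
open import Data.Bool using (Bool; true; false)
open import Data.Fin using (Fin)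
open import Data.Fin.Subset using (Subset; _∈_; _⊂_; ∣_∣)
open import Data.Fin.Subset.Properties using (_∈?_)
open import Data.Fin.Properties using (any?; all?)
open import Data.Vec using (Vec; []; _∷_)
open import Data.List using (List; []; _∷_; _++_; [_]; length; filter; map)
open import Data.List.Relation.Unary.Unique.Propositional using (Unique)
open import Data.List.Relation.Unary.Linked using (Linked)
open import Data.Product using (Σ; ∃; _×_; _,_)
open import Data.Sum using (_⊎_)
open import Relation.Nullary using (¬_; Dec)
open import Relation.Nullary.Decidable using (_⊎-dec_; _×-dec_)
open import Relation.Binary.PropositionalEquality using (_≡_)
import Data.Nat as ℕ
import Data.Bool as B

record Graph (n : ℕ) : Set where
  field
    adj   : Fin n → Fin n → Bool
    sym   : ∀ u v → adj u v ≡ adj v u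
    irrefl : ∀ v → adj v v ≡ false

  Adj : Fin n → Fin n → Set
  Adj u v = adj u v ≡ true

open Graph public

module _ {n : ℕ} (G : Graph n) where

  data Walk : Fin n → Fin n → Set where
    nil  : ∀ {v} → Walk v v
    cons : ∀ {u v w} → Adj G u v → Walk v w → Walk u w

  Connected : Set
  Connected = ∀ u v → Walk u v

  HasCycle : Set
  HasCycle = Σ (Fin n) λ v → Σ (List (Fin n)) λ vs →
               (2 ≤ length vs) × Unique (v ∷ vs) × Linked (Adj G) (v ∷ vs ++ [ v ])

  IsTree : Set
  IsTree = 1 ≤ n × Connected × ¬ HasCycle

  Dominating : Subset n → Set
  Dominating S = ∀ v → v ∈ S ⊎ ∃ λ u → u ∈ S × Adj G u v

  dominating? : (S : Subset n) → Dec (Dominating S)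
  dominating? S = all? λ v → (v ∈? S) ⊎-dec any? (λ u → (u ∈? S) ×-dec (adj G u v B.≟ true))

  MinimalDominating : Subset n → Set
  MinimalDominating S = Dominating S × (∀ T → T ⊂ S → ¬ Dominating T)

  IsDominationNumber : ℕ → Set
  IsDominationNumber k = (∃ λ S → Dominating S × ∣ S ∣ ≡ k)
                       × (∀ S → Dominating S → k ≤ ∣ S ∣)

  IsUpperDominationNumber : ℕ → Set
  IsUpperDominationNumber k = (∃ λ S → MinimalDominating S × ∣ S ∣ ≡ k)
                            × (∀ S → MinimalDominating S → ∣ S ∣ ≤ k)

allSubsets : (m : ℕ) → List (Subset m)
allSubsets zero = [] ∷ []
allSubsets (suc m) = map (true ∷_) (allSubsets m) ++ map (false ∷_) (allSubsets m)

domCount : {n : ℕ} → Graph n → ℕ → ℕ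
domCount {n} G i = length (filter (λ S → (∣ S ∣ ℕ.≟ i) ×-dec dominating? G S) (allSubsets n))

Unimodal : (ℕ → ℕ) → ℕ → Set
Unimodal a d = Σ ℕ λ k → k ≤ d
             × (∀ i → i < k → a i ≤ a (suc i))
             × (∀ i → k ≤ i → i < d → a (suc i) ≤ a i)

-- Call v ∈ S removable from a dominating set S if S - v still dominates, and let r(S) count
-- them. Toggling one vertex matches the pairs (S′, v) with S′ dominating of size i and v ∉ S′
-- with the pairs (S, v) with S dominating of size i + 1 and v removable from S, so
-- (n - i)·d_i = Σ r(S) over the dominating sets S of size i + 1.
--
-- In a tree every dominating set S satisfies r(S) + 2γ ≤ 2|S| ≤ r(S) + 2Γ. For the left
-- inequality, two-colour the removable vertices so that deleting either colour class from S
-- leaves a dominating set, of size at least γ. For the right one, the isolated vertices of S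
-- together with either parity class of the vertices away from them are independent, hence lie
-- in a minimal dominating set, of size at most Γ; and the vertices of S that are neither
-- isolated nor removable have distinct private neighbours outside S, all away from the
-- isolated vertices.
--
-- Averaging over S gives (n - i)·d_i + 2γ·d_{i+1} ≤ 2(i + 1)·d_{i+1} ≤ (n - i)·d_i + 2Γ·d_{i+1}.
-- Hence d_i ≤ d_{i+1} while 3i + 2 ≤ n + 2γ and d_{i+1} ≤ d_i once n + 2Γ ≤ 3i + 2; when
-- Γ ≤ γ + 2, only the first index failing the former condition can lie between the two regimes.

module Submission where

open import Defs hiding (sym)
open import Level using (Level; _⊔_)
open import Data.Bool.Base using (Bool; true; false; not; _xor_; if_then_else_)
open import Data.Bool.Properties using (not-¬; ¬-not; not-involutive) renaming (_≟_ to _≟ᵇ_)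
open import Data.Fin.Base using (Fin; zero; suc; fromℕ<)
open import Data.Fin.Properties using (_≟_; any?; all?; ¬∀⟶∃¬; 0≢1+n)
  renaming (suc-injective to Fin-suc-injective)
open import Data.Fin.Subset using (Subset; _∈_; _∉_; _⊆_; ∣_∣; ∁; _-_; _∪_; ⁅_⁆)
open import Data.Fin.Subset.Properties
  using (_∈?_; x∉p⇒x∈∁p; x∈∁p⇒x∉p; ∣∁p∣≡n∸∣p∣; p─⊥≡p; p─q⊆p; p⊆p∪q; q⊆p∪q; x∈p∪q⁻; x∈⁅x⁆;
         x∈⁅y⁆⇒x≡y; x∈p∧x≢y⇒x∈p-y; p⊆q⇒∣p∣≤∣q∣)
open import Data.List.Base using (List; []; _∷_; _++_; [_]; map; filter; length; reverse; head; last; allFin)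
open import Data.List.Properties using (filter-++; length-++; ++-assoc; unfold-reverse; reverse-++; length-reverse)
open import Data.List.Membership.Propositional using () renaming (_∈_ to _∈ₗ_)
open import Data.List.Membership.Propositional.Properties using (∈-∃++; ∈-++⁺ˡ; ∈-allFin)
open import Data.List.Relation.Binary.Permutation.Propositional using (↭⇒↭ₛ; ↭-sym)
open import Data.List.Relation.Binary.Permutation.Propositional.Properties using (↭-reverse)
open import Data.List.Relation.Binary.Permutation.Setoid.Properties using (Unique-resp-↭)
open import Data.List.Relation.Unary.All as All using (All; []; _∷_)
import Data.List.Relation.Unary.All.Properties as All
open import Data.List.Relation.Unary.AllPairs using ([]; _∷_)
open import Data.List.Relation.Unary.Any as Any using (Any; here; there)
import Data.List.Relation.Unary.Any.Properties as AnyP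
open import Data.List.Relation.Unary.Linked using (Linked; []; [-]; _∷_)
import Data.List.Relation.Unary.Linked.Properties as Linked
open import Data.List.Relation.Unary.Unique.Propositional using (Unique)
import Data.List.Relation.Unary.Unique.Propositional.Properties as Unique
open import Data.Maybe.Base using (just)
open import Data.Maybe.Relation.Binary.Connected using (just) renaming (Connected to MaybeConnected)
open import Data.Nat.Base using (ℕ; zero; suc; _+_; _*_; _∸_; _≤_; _<_; NonZero; >-nonZero; z≤n; s≤s)
open import Data.Nat.Properties
  using (+-*-semiring; +-commutativeSemigroup; _≤?_; ≤-refl; ≤-trans; ≤-antisym; ≤-reflexive; ≤-pred;
         <⇒≤; <⇒≱; ≰⇒>; ≮⇒≥; <-trans; <-irrefl; n<1+n; m<n⇒m<1+n; m≤n⇒m<n∨m≡n; n≤0⇒n≡0; 1+n≢0;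
         suc-injective; +-comm; +-suc; *-comm; *-distribˡ-+; *-distribʳ-+; m≤m+n; m≤n+m; m∸n+n≡m;
         m<n⇒0<n∸m; +-mono-≤; +-monoˡ-≤; +-monoʳ-≤; *-monoˡ-≤; *-monoʳ-≤; +-cancelʳ-≤; *-cancelˡ-≤;
         module ≤-Reasoning)
  renaming (_≟_ to _≟ℕ_)
open import Data.Nat.Solver using (module +-*-Solver)
open import Algebra.Properties.CommutativeSemigroup +-commutativeSemigroup
  using () renaming (interchange to +-interchange)
open import Algebra.Properties.Semiring.Sum +-*-semiring
  using (sum; sum-syntax; ∑-distrib-+; ∑-comm; sum-cong-≗; *-distribˡ-sum)
open import Data.Product.Base using (Σ; ∃; ∃₂; _×_; _,_; proj₁; proj₂)
open import Data.Sum.Base as Sum using (_⊎_; inj₁; inj₂; [_,_]′)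
open import Data.Vec.Base using ([]; _∷_; lookup; tabulate; here; there; _[_]%=_)
open import Data.Vec.Properties using (lookup∘tabulate; []=⇒lookup; lookup⇒[]=)
open import Function.Base using (_∘_; id; case_of_)
open import Relation.Binary.Core using (Rel)
open import Relation.Binary.Definitions using (Symmetric; DecidableEquality)
open import Relation.Binary.PropositionalEquality
  using (_≡_; _≢_; refl; sym; trans; cong; cong₂; subst; subst₂; setoid; module ≡-Reasoning)
open import Relation.Nullary.Decidable
  using (Dec; yes; no; does; _×-dec_; _⊎-dec_; _→-dec_; ¬?; dec-true; dec-false)
open import Relation.Nullary.Negation using (¬_; contradiction)
open import Relation.Unary using (Pred; Decidable)
open import Relation.Unary.Properties using (_∩?_; _∪?_; ∁?)

open +-*-Solver using (solve; _:+_; _:*_; _:=_; con)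

private
  variable
    a b p q ℓ : Level
    A : Set a
    B : Set b
    n : ℕ

-- Counting over finite sets

sum-mono : {f g : Fin n → ℕ} → (∀ i → f i ≤ g i) → sum f ≤ sum g
sum-mono {zero}  f≤g = z≤n
sum-mono {suc n} f≤g = +-mono-≤ (f≤g zero) (sum-mono (f≤g ∘ suc))

term≤sum : (f : Fin n → ℕ) (i : Fin n) → f i ≤ sum f
term≤sum f zero    = m≤m+n (f zero) _
term≤sum f (suc i) = ≤-trans (term≤sum (f ∘ suc) i) (m≤n+m _ (f zero))

indicator : Dec A → ℕ
indicator A? = if does A? then 1 else 0

indicator-mono : (A? : Dec A) (B? : Dec B) → (A → B) → indicator A? ≤ indicator B?
indicator-mono (yes _) (yes _) _   = ≤-refl
indicator-mono (yes a) (no ¬b) A⇒B = contradiction (A⇒B a) ¬b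
indicator-mono (no _)  _       _   = z≤n

indicator-cong : (A? : Dec A) (B? : Dec B) → (A → B) → (B → A) → indicator A? ≡ indicator B?
indicator-cong A? B? A⇒B B⇒A = ≤-antisym (indicator-mono A? B? A⇒B) (indicator-mono B? A? B⇒A)

indicator-split : (A? : Dec A) (B? : Dec B) →
                  indicator A? ≡ indicator (A? ×-dec B?) + indicator (A? ×-dec ¬? B?)
indicator-split (yes _) (yes _) = refl
indicator-split (yes _) (no _)  = refl
indicator-split (no _)  _       = refl

indicator-× : (A? : Dec A) (B? : Dec B) → indicator A? * indicator B? ≡ indicator (A? ×-dec B?)
indicator-× (yes _) (yes _) = refl
indicator-× (yes _) (no _)  = refl
indicator-× (no _)  _       = refl

indicator-∪ : (A? : Dec A) (B? : Dec B) → (A → ¬ B) →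
              indicator (A? ⊎-dec B?) ≡ indicator A? + indicator B?
indicator-∪ (yes a) (yes b) A⇒¬B = contradiction b (A⇒¬B a)
indicator-∪ (yes _) (no _)  _    = refl
indicator-∪ (no _)  (yes _) _    = refl
indicator-∪ (no _)  (no _)  _    = refl

indicator-*-cong : ∀ (A? : Dec A) {x y} → (A → x ≡ y) → indicator A? * x ≡ indicator A? * y
indicator-*-cong (yes a) x≡y = cong (1 *_) (x≡y a)
indicator-*-cong (no _)  x≡y = refl

indicator-*-mono : ∀ (A? : Dec A) {x y} → (A → x ≤ y) → indicator A? * x ≤ indicator A? * y
indicator-*-mono (yes a) x≤y = +-mono-≤ (x≤y a) z≤n
indicator-*-mono (no _)  x≤y = z≤n

count : {P : Pred (Fin n) p} → Decidable P → ℕ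
count P? = sum (indicator ∘ P?)

module _ {P : Pred (Fin n) p} {Q : Pred (Fin n) q} (P? : Decidable P) (Q? : Decidable Q) where

  count-cong : (∀ {i} → P i → Q i) → (∀ {i} → Q i → P i) → count P? ≡ count Q?
  count-cong P⇒Q Q⇒P = sum-cong-≗ (λ i → indicator-cong (P? i) (Q? i) P⇒Q Q⇒P)

  count-split : count P? ≡ count (P? ∩? Q?) + count (P? ∩? ∁? Q?)
  count-split = trans (sum-cong-≗ (λ i → indicator-split (P? i) (Q? i)))
                      (∑-distrib-+ (indicator ∘ (P? ∩? Q?)) (indicator ∘ (P? ∩? ∁? Q?)))

  count-∪ : (∀ {i} → P i → ¬ Q i) → count (P? ∪? Q?) ≡ count P? + count Q?
  count-∪ disjoint = trans (sum-cong-≗ (λ i → indicator-∪ (P? i) (Q? i) disjoint))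
                           (∑-distrib-+ (indicator ∘ P?) (indicator ∘ Q?))

count-empty : ∀ {n} {P : Pred (Fin n) p} (P? : Decidable P) → (∀ i → ¬ P i) → count P? ≡ 0
count-empty {n = zero}  P? ¬P = refl
count-empty {n = suc n} P? ¬P with P? zero
... | yes p₀ = contradiction p₀ (¬P zero)
... | no _   = count-empty (P? ∘ suc) (¬P ∘ suc)

count-≤-indicator : ∀ {n} {P : Pred (Fin n) p} (P? : Decidable P) (A? : Dec A) →
                    (∀ {i} → P i → A) → (∀ {i j} → P i → P j → i ≡ j) → count P? ≤ indicator A?
count-≤-indicator {n = zero}  P? A? P⇒A unique = z≤n
count-≤-indicator {n = suc n} P? A? P⇒A unique with P? zero
... | no _ = count-≤-indicator (P? ∘ suc) A? P⇒A (λ pᵢ pⱼ → Fin-suc-injective (unique pᵢ pⱼ))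
... | yes p₀ with A?
...   | yes _ = ≤-reflexive (cong suc (count-empty (P? ∘ suc) (λ i pᵢ → 0≢1+n (unique p₀ pᵢ))))
...   | no ¬a = contradiction (P⇒A p₀) ¬a

count-≤-matching : ∀ {n r} {P : Pred (Fin n) p} {Q : Pred (Fin n) q} {R : Fin n → Fin n → Set r} →
                   (P? : Decidable P) (Q? : Decidable Q) (R? : ∀ i j → Dec (R i j)) →
                   (∀ {i} → P i → ∃ (R i)) → (∀ {i j} → R i j → Q j) →
                   (∀ {i i′ j} → R i j → R i′ j → i ≡ i′) →
                   count P? ≤ count Q?
count-≤-matching {n = n} P? Q? R? total into injective = begin
  count P?                                  ≤⟨ sum-mono matched ⟩
  ∑[ i < n ] ∑[ j < n ] indicator (R? i j)  ≡⟨ ∑-comm (λ i j → indicator (R? i j)) ⟩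
  ∑[ j < n ] ∑[ i < n ] indicator (R? i j)  ≤⟨ sum-mono (λ j → count-≤-indicator (λ i → R? i j) (Q? j)
                                                                                 into injective) ⟩
  count Q?                                  ∎
  where
  open ≤-Reasoning
  matched : ∀ i → indicator (P? i) ≤ ∑[ j < n ] indicator (R? i j)
  matched i with P? i
  ... | no _   = z≤n
  ... | yes pᵢ with j , rᵢⱼ ← total pᵢ =
    ≤-trans (indicator-mono (yes pᵢ) (R? i j) (λ _ → rᵢⱼ)) (term≤sum _ j)

∣p∣≡count-∈ : (S : Subset n) → ∣ S ∣ ≡ count (_∈? S)
∣p∣≡count-∈ []          = refl
∣p∣≡count-∈ (true ∷ S)  = cong suc (∣p∣≡count-∈ S)
∣p∣≡count-∈ (false ∷ S) = ∣p∣≡count-∈ S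

count-∉ : (S : Subset n) → count (∁? (_∈? S)) ≡ n ∸ ∣ S ∣
count-∉ S = begin
  count (∁? (_∈? S))  ≡⟨ count-cong (∁? (_∈? S)) (_∈? ∁ S) x∉p⇒x∈∁p x∈∁p⇒x∉p ⟩
  count (_∈? ∁ S)     ≡⟨ ∣p∣≡count-∈ (∁ S) ⟨
  ∣ ∁ S ∣             ≡⟨ ∣∁p∣≡n∸∣p∣ S ⟩
  _ ∸ ∣ S ∣           ∎
  where open ≡-Reasoning

subsetOf : {P : Pred (Fin n) p} → Decidable P → Subset n
subsetOf P? = tabulate (does ∘ P?)

module _ {P : Pred (Fin n) p} (P? : Decidable P) where

  ∈-subsetOf⁺ : ∀ {i} → P i → i ∈ subsetOf P?
  ∈-subsetOf⁺ {i} pᵢ = lookup⇒[]= i _ (trans (lookup∘tabulate (does ∘ P?) i) (dec-true (P? i) pᵢ))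

  ∈-subsetOf⁻ : ∀ {i} → i ∈ subsetOf P? → P i
  ∈-subsetOf⁻ {i} i∈ with P? i | trans (sym (lookup∘tabulate (does ∘ P?) i)) ([]=⇒lookup i∈)
  ... | yes pᵢ | _ = pᵢ

  ∣subsetOf∣ : ∣ subsetOf P? ∣ ≡ count P?
  ∣subsetOf∣ = trans (∣p∣≡count-∈ (subsetOf P?)) (count-cong (_∈? subsetOf P?) P? ∈-subsetOf⁻ ∈-subsetOf⁺)

toggle : Fin n → Subset n → Subset n
toggle i S = S [ i ]%= not

toggle-∈ : ∀ {v : Fin n} {S} → v ∈ S → toggle v S ≡ S - v
toggle-∈ {v = zero}  {true ∷ S} here        = cong (false ∷_) (sym (p─⊥≡p S))
toggle-∈ {v = suc v} {x ∷ S}    (there v∈S) = cong (x ∷_) (toggle-∈ v∈S)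

∉-toggle⇒∈ : ∀ {v : Fin n} {S} → v ∉ toggle v S → v ∈ S
∉-toggle⇒∈ {v = zero}  {true ∷ S}  _  = here
∉-toggle⇒∈ {v = zero}  {false ∷ S} v∉ = contradiction here v∉
∉-toggle⇒∈ {v = suc v} {x ∷ S}     v∉ = there (∉-toggle⇒∈ (v∉ ∘ there))

x∉p-x : ∀ {v : Fin n} {S} → v ∉ S - v
x∉p-x {v = zero}  {x ∷ S} ()
x∉p-x {v = suc v} {x ∷ S} (there v∈) = x∉p-x v∈

∣p-x∣+1≡∣p∣ : ∀ {v : Fin n} {S} → v ∈ S → suc ∣ S - v ∣ ≡ ∣ S ∣
∣p-x∣+1≡∣p∣ {v = zero}  {true ∷ S}  here        = cong (suc ∘ ∣_∣) (p─⊥≡p S)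
∣p-x∣+1≡∣p∣ {v = suc v} {true ∷ S}  (there v∈S) = cong suc (∣p-x∣+1≡∣p∣ v∈S)
∣p-x∣+1≡∣p∣ {v = suc v} {false ∷ S} (there v∈S) = ∣p-x∣+1≡∣p∣ v∈S

sumSubsets : (Subset n → ℕ) → ℕ
sumSubsets {zero}  f = f []
sumSubsets {suc n} f = sumSubsets (f ∘ (true ∷_)) + sumSubsets (f ∘ (false ∷_))

sumSubsets-cong : {f g : Subset n → ℕ} → (∀ S → f S ≡ g S) → sumSubsets f ≡ sumSubsets g
sumSubsets-cong {zero}  f≗g = f≗g []
sumSubsets-cong {suc n} f≗g =
  cong₂ _+_ (sumSubsets-cong (f≗g ∘ (true ∷_))) (sumSubsets-cong (f≗g ∘ (false ∷_)))

sumSubsets-mono : {f g : Subset n → ℕ} → (∀ S → f S ≤ g S) → sumSubsets f ≤ sumSubsets g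
sumSubsets-mono {zero}  f≤g = f≤g []
sumSubsets-mono {suc n} f≤g =
  +-mono-≤ (sumSubsets-mono (f≤g ∘ (true ∷_))) (sumSubsets-mono (f≤g ∘ (false ∷_)))

sumSubsets-distrib-+ : (f g : Subset n → ℕ) →
                       sumSubsets (λ S → f S + g S) ≡ sumSubsets f + sumSubsets g
sumSubsets-distrib-+ {zero}  f g = refl
sumSubsets-distrib-+ {suc n} f g = trans
  (cong₂ _+_ (sumSubsets-distrib-+ (f ∘ (true ∷_)) (g ∘ (true ∷_)))
             (sumSubsets-distrib-+ (f ∘ (false ∷_)) (g ∘ (false ∷_))))
  (+-interchange (sumSubsets (f ∘ (true ∷_))) _ _ _)

*-distribˡ-sumSubsets : ∀ c (f : Subset n → ℕ) → c * sumSubsets f ≡ sumSubsets (λ S → c * f S)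
*-distribˡ-sumSubsets {zero}  c f = refl
*-distribˡ-sumSubsets {suc n} c f = trans (*-distribˡ-+ c (sumSubsets (f ∘ (true ∷_))) _)
  (cong₂ _+_ (*-distribˡ-sumSubsets c (f ∘ (true ∷_))) (*-distribˡ-sumSubsets c (f ∘ (false ∷_))))

sumSubsets-comm : ∀ {m} (f : Subset n → Fin m → ℕ) →
                  sumSubsets (λ S → ∑[ i < m ] f S i) ≡ ∑[ i < m ] sumSubsets (λ S → f S i)
sumSubsets-comm {n = n} {m = zero} f = sumSubsets-zero n
  where
  sumSubsets-zero : ∀ n → sumSubsets {n} (λ _ → 0) ≡ 0
  sumSubsets-zero zero    = refl
  sumSubsets-zero (suc n) = cong₂ _+_ (sumSubsets-zero n) (sumSubsets-zero n)
sumSubsets-comm {m = suc m} f =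
  trans (sumSubsets-distrib-+ (λ S → f S zero) (λ S → ∑[ i < m ] f S (suc i)))
        (cong (sumSubsets (λ S → f S zero) +_) (sumSubsets-comm (λ S i → f S (suc i))))

sumSubsets-toggle : (i : Fin n) (f : Subset n → ℕ) → sumSubsets f ≡ sumSubsets (f ∘ toggle i)
sumSubsets-toggle zero    f = +-comm (sumSubsets (f ∘ (true ∷_))) _
sumSubsets-toggle (suc i) f =
  cong₂ _+_ (sumSubsets-toggle i (f ∘ (true ∷_))) (sumSubsets-toggle i (f ∘ (false ∷_)))

length-filter-map : ∀ {P : Pred B p} (P? : Decidable P) (f : A → B) xs →
                    length (filter P? (map f xs)) ≡ length (filter (P? ∘ f) xs)
length-filter-map P? f []       = refl
length-filter-map P? f (x ∷ xs) with does (P? (f x))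
... | true  = cong suc (length-filter-map P? f xs)
... | false = length-filter-map P? f xs

length-filter-allSubsets : ∀ {n} {P : Pred (Subset n) p} (P? : Decidable P) →
                           length (filter P? (allSubsets n)) ≡ sumSubsets (indicator ∘ P?)
length-filter-allSubsets {n = zero} P? with does (P? [])
... | true  = refl
... | false = refl
length-filter-allSubsets {n = suc n} P? = begin
  length (filter P? (map (true ∷_) Sₙ ++ map (false ∷_) Sₙ))
    ≡⟨ cong length (filter-++ P? (map (true ∷_) Sₙ) _) ⟩
  length (filter P? (map (true ∷_) Sₙ) ++ filter P? (map (false ∷_) Sₙ))
    ≡⟨ length-++ (filter P? (map (true ∷_) Sₙ)) ⟩
  length (filter P? (map (true ∷_) Sₙ)) + length (filter P? (map (false ∷_) Sₙ))
    ≡⟨ cong₂ _+_ (length-filter-map P? (true ∷_) Sₙ) (length-filter-map P? (false ∷_) Sₙ) ⟩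
  length (filter (P? ∘ (true ∷_)) Sₙ) + length (filter (P? ∘ (false ∷_)) Sₙ)
    ≡⟨ cong₂ _+_ (length-filter-allSubsets (P? ∘ (true ∷_))) (length-filter-allSubsets (P? ∘ (false ∷_))) ⟩
  sumSubsets (indicator ∘ P?) ∎
  where
  open ≡-Reasoning
  Sₙ : List (Subset n)
  Sₙ = allSubsets n

-- A unimodality criterion

first-failure : {U : Pred ℕ p} → Decidable U → ∀ d →
                (∀ i → i < d → U i) ⊎ (∃ λ k → k < d × ¬ U k × (∀ i → i < k → U i))
first-failure U? zero = inj₁ (λ _ ())
first-failure {U = U} U? (suc d) with first-failure U? d
... | inj₂ (k , k<d , ¬Uk , U<k) = inj₂ (k , m<n⇒m<1+n k<d , ¬Uk , U<k)
... | inj₁ U<d with U? d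
...   | no ¬Ud = inj₂ (d , n<1+n d , ¬Ud , U<d)
...   | yes Ud = inj₁ U<1+d
  where
  U<1+d : ∀ i → i < suc d → U i
  U<1+d i i<1+d with m≤n⇒m<n∨m≡n (≤-pred i<1+d)
  ... | inj₁ i<d  = U<d i i<d
  ... | inj₂ refl = Ud

unimodal-from-switch : (a : ℕ → ℕ) (d : ℕ) {U : Pred ℕ p} → Decidable U →
                       (∀ i → i < d → U i → a i ≤ a (suc i)) →
                       (∀ k i → ¬ U k → k < i → i < d → a (suc i) ≤ a i) →
                       Unimodal a d
unimodal-from-switch a d U? rise fall with first-failure U? d
... | inj₁ U<d =
  d , ≤-refl , (λ i i<d → rise i i<d (U<d i i<d)) , (λ i d≤i i<d → contradiction d≤i (<⇒≱ i<d))
... | inj₂ (k , k<d , ¬Uk , U<k) with a (suc k) ≤? a k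
...   | yes fallₖ = k , <⇒≤ k<d , (λ i i<k → rise i (<-trans i<k k<d) (U<k i i<k)) , fall≥k
  where
  fall≥k : ∀ i → k ≤ i → i < d → a (suc i) ≤ a i
  fall≥k i k≤i i<d with m≤n⇒m<n∨m≡n k≤i
  ... | inj₁ k<i  = fall k i ¬Uk k<i i<d
  ... | inj₂ refl = fallₖ
...   | no ¬fallₖ = suc k , k<d , rise≤k , (λ i k<i i<d → fall k i ¬Uk k<i i<d)
  where
  rise≤k : ∀ i → i < suc k → a i ≤ a (suc i)
  rise≤k i i<1+k with m≤n⇒m<n∨m≡n (≤-pred i<1+k)
  ... | inj₁ i<k  = rise i (<-trans i<k k<d) (U<k i i<k)
  ... | inj₂ refl = <⇒≤ (≰⇒> ¬fallₖ)

≤-from-weighted : ∀ {c g s x y} .{{_ : NonZero c}} → c * x + g * y ≤ s * y → s ≤ c + g → x ≤ y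
≤-from-weighted {c} {g} {s} {x} {y} bound s≤c+g =
  *-cancelˡ-≤ c (+-cancelʳ-≤ (g * y) (c * x) (c * y) (begin
    c * x + g * y  ≤⟨ bound ⟩
    s * y          ≤⟨ *-monoˡ-≤ y s≤c+g ⟩
    (c + g) * y    ≡⟨ *-distribʳ-+ y c g ⟩
    c * y + g * y  ∎))
  where open ≤-Reasoning

≥-from-weighted : ∀ {c g s x y} .{{_ : NonZero c}} → s * y ≤ c * x + g * y → c + g ≤ s → y ≤ x
≥-from-weighted {c} {g} {s} {x} {y} bound c+g≤s =
  *-cancelˡ-≤ c (+-cancelʳ-≤ (g * y) (c * y) (c * x) (begin
    c * y + g * y  ≡⟨ *-distribʳ-+ y c g ⟨
    (c + g) * y    ≤⟨ *-monoˡ-≤ y c+g≤s ⟩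
    s * y          ≤⟨ bound ⟩
    c * x + g * y  ∎))
  where open ≤-Reasoning

private
  3i+2≡2[1+i]+i : ∀ i → 3 * i + 2 ≡ 2 * suc i + i
  3i+2≡2[1+i]+i = solve 1 (λ i → con 3 :* i :+ con 2 := con 2 :* (con 1 :+ i) :+ i) refl

  n+g≡[n∸i+g]+i : ∀ {i n} g → i ≤ n → n + g ≡ (n ∸ i + g) + i
  n+g≡[n∸i+g]+i {i} {n} g i≤n = trans (cong (_+ g) (sym (m∸n+n≡m i≤n)))
    (solve 3 (λ c i g → (c :+ i) :+ g := (c :+ g) :+ i) refl (n ∸ i) i g)

threshold-below : ∀ {i n g} → i ≤ n → 3 * i + 2 ≤ n + g → 2 * suc i ≤ n ∸ i + g
threshold-below {i} {n} {g} i≤n below = +-cancelʳ-≤ i _ _ (begin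
  2 * suc i + i    ≡⟨ 3i+2≡2[1+i]+i i ⟨
  3 * i + 2        ≤⟨ below ⟩
  n + g            ≡⟨ n+g≡[n∸i+g]+i g i≤n ⟩
  (n ∸ i + g) + i  ∎)
  where open ≤-Reasoning

threshold-above : ∀ {i n g} → i ≤ n → n + g ≤ 3 * i + 2 → n ∸ i + g ≤ 2 * suc i
threshold-above {i} {n} {g} i≤n above = +-cancelʳ-≤ i _ _ (begin
  (n ∸ i + g) + i  ≡⟨ n+g≡[n∸i+g]+i g i≤n ⟨
  n + g            ≤⟨ above ⟩
  3 * i + 2        ≡⟨ 3i+2≡2[1+i]+i i ⟩
  2 * suc i + i    ∎)
  where open ≤-Reasoning

past-threshold : ∀ {n γ Γ k i} → Γ ≤ γ + 2 → ¬ (3 * k + 2 ≤ n + 2 * γ) → k < i →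
                 n + 2 * Γ ≤ 3 * i + 2
past-threshold {n} {γ} {Γ} {k} {i} Γ≤γ+2 ¬below k<i = begin
  n + 2 * Γ            ≤⟨ +-monoʳ-≤ n (*-monoʳ-≤ 2 Γ≤γ+2) ⟩
  n + 2 * (γ + 2)      ≡⟨ solve 2 (λ n γ → n :+ con 2 :* (γ :+ con 2) := con 1 :+ (n :+ con 2 :* γ) :+ con 3)
                                refl n γ ⟩
  suc (n + 2 * γ) + 3  ≤⟨ +-monoˡ-≤ 3 (≰⇒> ¬below) ⟩
  3 * k + 2 + 3        ≡⟨ solve 1 (λ k → con 3 :* k :+ con 2 :+ con 3 := con 3 :* (con 1 :+ k) :+ con 2) refl k ⟩
  3 * suc k + 2        ≤⟨ +-monoˡ-≤ 2 (*-monoʳ-≤ 3 k<i) ⟩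
  3 * i + 2            ∎
  where open ≤-Reasoning

unimodal-from-removal-bounds :
  ∀ (a : ℕ → ℕ) n γ Γ → Γ ≤ γ + 2 →
  (∀ i → (n ∸ i) * a i + 2 * γ * a (suc i) ≤ 2 * suc i * a (suc i)) →
  (∀ i → 2 * suc i * a (suc i) ≤ (n ∸ i) * a i + 2 * Γ * a (suc i)) →
  Unimodal a n
unimodal-from-removal-bounds a n γ Γ Γ≤γ+2 lower upper =
  unimodal-from-switch a n (λ i → 3 * i + 2 ≤? n + 2 * γ) rise fall
  where
  rise : ∀ i → i < n → 3 * i + 2 ≤ n + 2 * γ → a i ≤ a (suc i)
  rise i i<n below = ≤-from-weighted {{>-nonZero (m<n⇒0<n∸m i<n)}}
                       (lower i) (threshold-below (<⇒≤ i<n) below)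
  fall : ∀ k i → ¬ (3 * k + 2 ≤ n + 2 * γ) → k < i → i < n → a (suc i) ≤ a i
  fall k i ¬below k<i i<n = ≥-from-weighted {{>-nonZero (m<n⇒0<n∸m i<n)}}
                              (upper i) (threshold-above (<⇒≤ i<n) (past-threshold {n} Γ≤γ+2 ¬below k<i))

-- Dominating sets and removable vertices

module _ {n} (G : Graph n) where

  Adj-sym : ∀ {u v} → Adj G u v → Adj G v u
  Adj-sym {u} {v} uv = trans (Graph.sym G v u) uv

  Adj⇒≢ : ∀ {u v} → Adj G u v → u ≢ v
  Adj⇒≢ {u} uu refl with () ← trans (sym uu) (irrefl G u)

  adj? : ∀ u v → Dec (Adj G u v)
  adj? u v = adj G u v ≟ᵇ true

  Dominated : Subset n → Fin n → Set
  Dominated S v = v ∈ S ⊎ ∃ λ u → u ∈ S × Adj G u v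

  dominated? : ∀ S v → Dec (Dominated S v)
  dominated? S v = (v ∈? S) ⊎-dec any? (λ u → (u ∈? S) ×-dec adj? u v)

  dominated-mono : ∀ {S T v} → S ⊆ T → Dominated S v → Dominated T v
  dominated-mono S⊆T (inj₁ v∈S)            = inj₁ (S⊆T v∈S)
  dominated-mono S⊆T (inj₂ (u , u∈S , uv)) = inj₂ (u , S⊆T u∈S , uv)

  dominating-mono : ∀ {S T} → S ⊆ T → Dominating G S → Dominating G T
  dominating-mono S⊆T dom = dominated-mono S⊆T ∘ dom

  Removable : Subset n → Fin n → Set
  Removable S v = v ∈ S × Dominating G (S - v)

  removable? : ∀ S v → Dec (Removable S v)
  removable? S v = (v ∈? S) ×-dec dominating? G (S - v)

  removableCount : Subset n → ℕ
  removableCount S = count (removable? S)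

  removable-dominated : ∀ {S v} → Removable S v → ∀ w →
                        (w ∈ S × w ≢ v) ⊎ ∃ λ u → u ∈ S × u ≢ v × Adj G u w
  removable-dominated {S} {v} (_ , dom) w with dom w
  ... | inj₁ w∈S-v            = inj₁ (p─q⊆p S _ w∈S-v , λ { refl → x∉p-x w∈S-v })
  ... | inj₂ (u , u∈S-v , uw) = inj₂ (u , p─q⊆p S _ u∈S-v , (λ { refl → x∉p-x u∈S-v }) , uw)

  Independent : Subset n → Set
  Independent M = ∀ {u v} → u ∈ M → v ∈ M → ¬ Adj G u v

  independent-dominating⇒minimal : ∀ {M} → Independent M → Dominating G M → MinimalDominating G M
  independent-dominating⇒minimal independent dom = dom , λ where
    T (T⊆M , x , x∈M , x∉T) domT → case domT x of λ where
      (inj₁ x∈T)            → x∉T x∈T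
      (inj₂ (u , u∈T , ux)) → independent (T⊆M u∈T) x∈M ux

  grow : Subset n → Fin n → Subset n
  grow M v with dominated? M v
  ... | yes _ = M
  ... | no _  = M ∪ ⁅ v ⁆

  module _ {M : Subset n} {v : Fin n} where

    grow-⊇ : M ⊆ grow M v
    grow-⊇ with dominated? M v
    ... | yes _ = id
    ... | no _  = p⊆p∪q ⁅ v ⁆

    grow-dominates : Dominated (grow M v) v
    grow-dominates with dominated? M v
    ... | yes dominated = dominated
    ... | no _          = inj₁ (q⊆p∪q M ⁅ v ⁆ (x∈⁅x⁆ v))

    grow-independent : Independent M → Independent (grow M v)
    grow-independent independent with dominated? M v
    ... | yes _          = independent
    ... | no undominated = λ x∈ y∈ → joined (x∈p∪q⁻ M ⁅ v ⁆ x∈) (x∈p∪q⁻ M ⁅ v ⁆ y∈)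
      where
      joined : ∀ {x y} → x ∈ M ⊎ x ∈ ⁅ v ⁆ → y ∈ M ⊎ y ∈ ⁅ v ⁆ → ¬ Adj G x y
      joined (inj₁ x∈M) (inj₁ y∈M) xy = independent x∈M y∈M xy
      joined (inj₁ x∈M) (inj₂ y∈v) xy with refl ← x∈⁅y⁆⇒x≡y v y∈v =
        undominated (inj₂ (_ , x∈M , xy))
      joined (inj₂ x∈v) (inj₁ y∈M) xy with refl ← x∈⁅y⁆⇒x≡y v x∈v =
        undominated (inj₂ (_ , y∈M , Adj-sym xy))
      joined (inj₂ x∈v) (inj₂ y∈v) xy with refl ← x∈⁅y⁆⇒x≡y v x∈v | refl ← x∈⁅y⁆⇒x≡y v y∈v =
        Adj⇒≢ xy refl

  growAll : List (Fin n) → Subset n → Subset n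
  growAll []       M = M
  growAll (v ∷ vs) M = growAll vs (grow M v)

  growAll-⊇ : ∀ vs {M} → M ⊆ growAll vs M
  growAll-⊇ []       = id
  growAll-⊇ (v ∷ vs) = growAll-⊇ vs ∘ grow-⊇ {v = v}

  growAll-independent : ∀ vs {M} → Independent M → Independent (growAll vs M)
  growAll-independent []       = id
  growAll-independent (v ∷ vs) = growAll-independent vs ∘ grow-independent {v = v}

  growAll-dominates : ∀ vs {M v} → v ∈ₗ vs → Dominated (growAll vs M) v
  growAll-dominates (v ∷ vs) (here refl) = dominated-mono (growAll-⊇ vs) grow-dominates
  growAll-dominates (_ ∷ vs) (there v∈)  = growAll-dominates vs v∈

  independent⇒⊆minimalDominating : ∀ {I} → Independent I → ∃ λ M → I ⊆ M × MinimalDominating G M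
  independent⇒⊆minimalDominating {I} independent =
    M , growAll-⊇ (allFin n) ,
    independent-dominating⇒minimal (growAll-independent (allFin n) independent)
                                   (λ v → growAll-dominates (allFin n) (∈-allFin v))
    where
    M : Subset n
    M = growAll (allFin n) I

  DominatingOfSize : ℕ → Subset n → Set
  DominatingOfSize i S = ∣ S ∣ ≡ i × Dominating G S

  dominatingOfSize? : ∀ i S → Dec (DominatingOfSize i S)
  dominatingOfSize? i S = (∣ S ∣ ≟ℕ i) ×-dec dominating? G S

  domCount≡sumSubsets : ∀ i → domCount G i ≡ sumSubsets (indicator ∘ dominatingOfSize? i)
  domCount≡sumSubsets i = length-filter-allSubsets (dominatingOfSize? i)

  module _ {i : ℕ} {v : Fin n} {S : Subset n} where

    toggle-outside⇒removable : DominatingOfSize i (toggle v S) × v ∉ toggle v S →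
                               DominatingOfSize (suc i) S × Removable S v
    toggle-outside⇒removable ((∣S-v∣≡i , dom) , v∉) =
      (∣S∣≡1+i , dominating-mono (p─q⊆p S _) dom-v) , v∈S , dom-v
      where
      v∈S : v ∈ S
      v∈S = ∉-toggle⇒∈ v∉
      dom-v : Dominating G (S - v)
      dom-v = subst (Dominating G) (toggle-∈ v∈S) dom
      ∣S∣≡1+i : ∣ S ∣ ≡ suc i
      ∣S∣≡1+i = trans (sym (∣p-x∣+1≡∣p∣ v∈S)) (cong suc (trans (cong ∣_∣ (sym (toggle-∈ v∈S))) ∣S-v∣≡i))

    removable⇒toggle-outside : DominatingOfSize (suc i) S × Removable S v →
                               DominatingOfSize i (toggle v S) × v ∉ toggle v S
    removable⇒toggle-outside ((∣S∣≡1+i , _) , v∈S , dom-v) rewrite toggle-∈ v∈S =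
      (suc-injective (trans (∣p-x∣+1≡∣p∣ v∈S) ∣S∣≡1+i) , dom-v) , x∉p-x

  removal-identity : ∀ i → (n ∸ i) * domCount G i ≡
                     sumSubsets (λ S → indicator (dominatingOfSize? (suc i) S) * removableCount S)
  removal-identity i = begin
    (n ∸ i) * domCount G i
      ≡⟨ cong ((n ∸ i) *_) (domCount≡sumSubsets i) ⟩
    (n ∸ i) * sumSubsets Dᵢ
      ≡⟨ *-distribˡ-sumSubsets (n ∸ i) Dᵢ ⟩
    sumSubsets (λ S → (n ∸ i) * Dᵢ S)
      ≡⟨ sumSubsets-cong (λ S → trans (*-comm (n ∸ i) (Dᵢ S)) (outside-count S)) ⟩
    sumSubsets (λ S → Dᵢ S * count (∁? (_∈? S)))
      ≡⟨ sumSubsets-cong (λ S → *-distribˡ-sum (Dᵢ S) (indicator ∘ ∁? (_∈? S))) ⟩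
    sumSubsets (λ S → ∑[ v < n ] (Dᵢ S * indicator (¬? (v ∈? S))))
      ≡⟨ sumSubsets-comm (λ S v → Dᵢ S * indicator (¬? (v ∈? S))) ⟩
    ∑[ v < n ] sumSubsets (λ S → Dᵢ S * indicator (¬? (v ∈? S)))
      ≡⟨ sum-cong-≗ (λ v → sumSubsets-toggle v (λ S → Dᵢ S * indicator (¬? (v ∈? S)))) ⟩
    ∑[ v < n ] sumSubsets (λ S → Dᵢ (toggle v S) * indicator (¬? (v ∈? toggle v S)))
      ≡⟨ sum-cong-≗ (λ v → sumSubsets-cong (toggled v)) ⟩
    ∑[ v < n ] sumSubsets (λ S → Dᵢ₊₁ S * indicator (removable? S v))
      ≡⟨ sumSubsets-comm (λ S v → Dᵢ₊₁ S * indicator (removable? S v)) ⟨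
    sumSubsets (λ S → ∑[ v < n ] (Dᵢ₊₁ S * indicator (removable? S v)))
      ≡⟨ sumSubsets-cong (λ S → *-distribˡ-sum (Dᵢ₊₁ S) (indicator ∘ removable? S)) ⟨
    sumSubsets (λ S → Dᵢ₊₁ S * removableCount S) ∎
    where
    open ≡-Reasoning
    Dᵢ Dᵢ₊₁ : Subset n → ℕ
    Dᵢ   = indicator ∘ dominatingOfSize? i
    Dᵢ₊₁ = indicator ∘ dominatingOfSize? (suc i)
    outside-count : ∀ S → Dᵢ S * (n ∸ i) ≡ Dᵢ S * count (∁? (_∈? S))
    outside-count S = indicator-*-cong (dominatingOfSize? i S)
                        (λ (∣S∣≡i , _) → trans (cong (n ∸_) (sym ∣S∣≡i)) (sym (count-∉ S)))
    toggled : ∀ v S → Dᵢ (toggle v S) * indicator (¬? (v ∈? toggle v S)) ≡ Dᵢ₊₁ S * indicator (removable? S v)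
    toggled v S = begin
      Dᵢ (toggle v S) * indicator (¬? (v ∈? toggle v S))
        ≡⟨ indicator-× (dominatingOfSize? i (toggle v S)) (¬? (v ∈? toggle v S)) ⟩
      indicator (dominatingOfSize? i (toggle v S) ×-dec ¬? (v ∈? toggle v S))
        ≡⟨ indicator-cong (dominatingOfSize? i (toggle v S) ×-dec ¬? (v ∈? toggle v S))
                          (dominatingOfSize? (suc i) S ×-dec removable? S v)
                          toggle-outside⇒removable removable⇒toggle-outside ⟩
      indicator (dominatingOfSize? (suc i) S ×-dec removable? S v)
        ≡⟨ indicator-× (dominatingOfSize? (suc i) S) (removable? S v) ⟨
      Dᵢ₊₁ S * indicator (removable? S v) ∎

  private
    weighted-count : ∀ i x → sumSubsets (λ S → indicator (dominatingOfSize? i S) * x) ≡ x * domCount G i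
    weighted-count i x = begin
      sumSubsets (λ S → Dᵢ S * x)  ≡⟨ sumSubsets-cong (λ S → *-comm (Dᵢ S) x) ⟩
      sumSubsets (λ S → x * Dᵢ S)  ≡⟨ *-distribˡ-sumSubsets x Dᵢ ⟨
      x * sumSubsets Dᵢ            ≡⟨ cong (x *_) (domCount≡sumSubsets i) ⟨
      x * domCount G i             ∎
      where
      open ≡-Reasoning
      Dᵢ : Subset n → ℕ
      Dᵢ = indicator ∘ dominatingOfSize? i

    shifted-removal-identity : ∀ i c →
      sumSubsets (λ S → indicator (dominatingOfSize? (suc i) S) * (removableCount S + c)) ≡
      (n ∸ i) * domCount G i + c * domCount G (suc i)
    shifted-removal-identity i c = begin
      sumSubsets (λ S → Dᵢ₊₁ S * (removableCount S + c))
        ≡⟨ sumSubsets-cong (λ S → *-distribˡ-+ (Dᵢ₊₁ S) (removableCount S) c) ⟩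
      sumSubsets (λ S → Dᵢ₊₁ S * removableCount S + Dᵢ₊₁ S * c)
        ≡⟨ sumSubsets-distrib-+ (λ S → Dᵢ₊₁ S * removableCount S) (λ S → Dᵢ₊₁ S * c) ⟩
      sumSubsets (λ S → Dᵢ₊₁ S * removableCount S) + sumSubsets (λ S → Dᵢ₊₁ S * c)
        ≡⟨ cong₂ _+_ (sym (removal-identity i)) (weighted-count (suc i) c) ⟩
      (n ∸ i) * domCount G i + c * domCount G (suc i) ∎
      where
      open ≡-Reasoning
      Dᵢ₊₁ : Subset n → ℕ
      Dᵢ₊₁ = indicator ∘ dominatingOfSize? (suc i)

  domCount-lower : ∀ c → (∀ S → Dominating G S → removableCount S + c ≤ 2 * ∣ S ∣) →
                   ∀ i → (n ∸ i) * domCount G i + c * domCount G (suc i) ≤ 2 * suc i * domCount G (suc i)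
  domCount-lower c bound i = begin
    (n ∸ i) * domCount G i + c * domCount G (suc i)
      ≡⟨ shifted-removal-identity i c ⟨
    sumSubsets (λ S → indicator (dominatingOfSize? (suc i) S) * (removableCount S + c))
      ≤⟨ sumSubsets-mono (λ S → indicator-*-mono (dominatingOfSize? (suc i) S) (λ (∣S∣≡1+i , dom) →
           subst (λ s → removableCount S + c ≤ 2 * s) ∣S∣≡1+i (bound S dom))) ⟩
    sumSubsets (λ S → indicator (dominatingOfSize? (suc i) S) * (2 * suc i))
      ≡⟨ weighted-count (suc i) (2 * suc i) ⟩
    2 * suc i * domCount G (suc i) ∎
    where open ≤-Reasoning

  domCount-upper : ∀ c → (∀ S → Dominating G S → 2 * ∣ S ∣ ≤ removableCount S + c) →
                   ∀ i → 2 * suc i * domCount G (suc i) ≤ (n ∸ i) * domCount G i + c * domCount G (suc i)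
  domCount-upper c bound i = begin
    2 * suc i * domCount G (suc i)
      ≡⟨ weighted-count (suc i) (2 * suc i) ⟨
    sumSubsets (λ S → indicator (dominatingOfSize? (suc i) S) * (2 * suc i))
      ≤⟨ sumSubsets-mono (λ S → indicator-*-mono (dominatingOfSize? (suc i) S) (λ (∣S∣≡1+i , dom) →
           subst (λ s → 2 * s ≤ removableCount S + c) ∣S∣≡1+i (bound S dom))) ⟩
    sumSubsets (λ S → indicator (dominatingOfSize? (suc i) S) * (removableCount S + c))
      ≡⟨ shifted-removal-identity i c ⟩
    (n ∸ i) * domCount G i + c * domCount G (suc i) ∎
    where open ≤-Reasoning

-- Cycles through an edge

Cycle : {A : Set a} → Rel A ℓ → Set (a ⊔ ℓ)
Cycle {A = A} R = Σ A λ x → Σ (List A) λ vs →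
                  2 ≤ length vs × Unique (x ∷ vs) × Linked R (x ∷ vs ++ [ x ])

split-at-first : ∀ {P : Pred A p} → Decidable P → ∀ {xs} → Any P xs →
                 ∃₂ λ pre x → ∃ λ post → xs ≡ pre ++ x ∷ post × All (λ y → ¬ P y) pre × P x
split-at-first P? {x ∷ xs} any with P? x | any
... | yes px | _          = [] , x , xs , refl , [] , px
... | no ¬px | here px    = contradiction px ¬px
... | no ¬px | there any′ with pre , y , post , refl , ¬P-pre , py ← split-at-first P? any′ =
  x ∷ pre , y , post , refl , ¬px ∷ ¬P-pre , py

Unique-++⁻ˡ : ∀ (xs : List A) {ys} → Unique (xs ++ ys) → Unique xs
Unique-++⁻ˡ []       _           = []
Unique-++⁻ˡ (x ∷ xs) (x∉ ∷ uniq) = All.++⁻ˡ xs x∉ ∷ Unique-++⁻ˡ xs uniq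

Unique-reverse : ∀ {xs : List A} → Unique xs → Unique (reverse xs)
Unique-reverse {A = A} {xs} = Unique-resp-↭ (setoid A) (↭⇒↭ₛ (↭-sym (↭-reverse xs)))

Linked-++⁻ˡ : ∀ {R : Rel A ℓ} (xs : List A) {ys} → Linked R (xs ++ ys) → Linked R xs
Linked-++⁻ˡ []           _            = []
Linked-++⁻ˡ (x ∷ [])     _            = [-]
Linked-++⁻ˡ (x ∷ y ∷ xs) (Rxy ∷ rest) = Rxy ∷ Linked-++⁻ˡ (y ∷ xs) rest

last-∷ʳ : ∀ (xs : List A) {x} → last (xs ++ [ x ]) ≡ just x
last-∷ʳ []           = refl
last-∷ʳ (y ∷ [])     = refl
last-∷ʳ (y ∷ z ∷ zs) = last-∷ʳ (z ∷ zs)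

last-reverse : ∀ (xs : List A) → last (reverse xs) ≡ head xs
last-reverse []       = refl
last-reverse (x ∷ xs) = trans (cong last (unfold-reverse x xs)) (last-∷ʳ (reverse xs))

head-++-∷ : ∀ (xs : List A) {x ys} → head (xs ++ x ∷ ys) ≡ head (xs ++ [ x ])
head-++-∷ []      = refl
head-++-∷ (_ ∷ _) = refl

Linked-reverse : ∀ {R : Rel A ℓ} → Symmetric R → ∀ {xs} → Linked R xs → Linked R (reverse xs)
Linked-reverse R-sym []                  = []
Linked-reverse R-sym [-]                 = [-]
Linked-reverse {R = R} R-sym {x ∷ y ∷ xs} (Rxy ∷ linked) =
  subst (Linked R) (sym (unfold-reverse x (y ∷ xs)))
    (Linked.++⁺ (Linked-reverse R-sym linked)
                (subst (λ m → MaybeConnected R m (just x)) (sym (last-reverse (y ∷ xs))) (just (R-sym Rxy)))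
                [-])

cycle-length : ∀ {u v x : A} {xs ys pre pre₂ post post₂} →
               u ≢ v → head xs ≢ just v → head ys ≢ just u →
               u ∷ xs ≡ pre ++ x ∷ post → v ∷ ys ≡ pre₂ ++ x ∷ post₂ → 2 ≤ length pre₂ + length pre
cycle-length {pre = []}          {[]}        u≢v _    _    refl refl = contradiction refl u≢v
cycle-length {pre = []}          {_ ∷ []}    _   _    ys≢u refl refl = contradiction refl ys≢u
cycle-length {pre = []}          {_ ∷ _ ∷ _} _   _    _    refl refl = s≤s (s≤s z≤n)
cycle-length {pre = _ ∷ []}      {[]}        _   xs≢v _    refl refl = contradiction refl xs≢v
cycle-length {pre = _ ∷ []}      {_ ∷ pre₂}  _   _    _    refl refl = s≤s (m≤n+m 1 (length pre₂))
cycle-length {pre = _ ∷ _ ∷ pre} {pre₂}      _   _    _    _    _    =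
  ≤-trans (s≤s (s≤s z≤n)) (m≤n+m _ (length pre₂))

module _ (_≟_ : DecidableEquality A) {R : Rel A ℓ} (R-sym : Symmetric R) where

  open import Data.List.Membership.DecPropositional _≟_ using () renaming (_∈?_ to _∈ₗ?_)

  -- With x the first vertex of u ∷ xs lying on v ∷ ys, the cycle runs from x back along
  -- v ∷ ys to v, across the edge to u, and along u ∷ xs to x.
  cycle-through-edge : ∀ {u v xs ys} → Unique (u ∷ xs) → Unique (v ∷ ys) →
                       Linked R (u ∷ xs) → Linked R (v ∷ ys) →
                       R u v → u ≢ v → head xs ≢ just v → head ys ≢ just u →
                       ∀ {z} → z ∈ₗ u ∷ xs → z ∈ₗ v ∷ ys → Cycle R
  cycle-through-edge {u} {v} {xs} {ys} uniq₁ uniq₂ linked₁ linked₂ Ruv u≢v xs≢v ys≢u z∈₁ z∈₂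
    with pre , x , post , eq₁ , pre∉ , x∈ ← split-at-first (_∈ₗ? v ∷ ys) (Any.map (λ { refl → z∈₂ }) z∈₁)
    with pre₂ , post₂ , eq₂ ← ∈-∃++ x∈ = x , reverse pre₂ ++ pre , length-ok , unique , linked
    where
    Q P : List A
    Q = pre₂ ++ [ x ]
    P = pre ++ [ x ]
    eq₂′ : v ∷ ys ≡ Q ++ post₂
    eq₂′ = trans eq₂ (sym (++-assoc pre₂ [ x ] post₂))
    eq₁′ : u ∷ xs ≡ P ++ post
    eq₁′ = trans eq₁ (sym (++-assoc pre [ x ] post))
    reverse-Q : reverse Q ≡ x ∷ reverse pre₂
    reverse-Q = reverse-++ pre₂ [ x ]
    length-ok : 2 ≤ length (reverse pre₂ ++ pre)
    length-ok = subst (2 ≤_) (sym (trans (length-++ (reverse pre₂)) (cong (_+ length pre) (length-reverse pre₂))))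
                      (cycle-length u≢v xs≢v ys≢u eq₁ eq₂)
    disjoint : ∀ {y} → ¬ (y ∈ₗ reverse Q × y ∈ₗ pre)
    disjoint (y∈Q , y∈pre) = All.lookup pre∉ y∈pre (subst (_ ∈ₗ_) (sym eq₂′) (∈-++⁺ˡ {xs = Q} (AnyP.reverse⁻ y∈Q)))
    unique : Unique (x ∷ reverse pre₂ ++ pre)
    unique = subst Unique (cong (_++ pre) reverse-Q)
      (Unique.++⁺ (Unique-reverse (Unique-++⁻ˡ Q (subst Unique eq₂′ uniq₂)))
                  (Unique-++⁻ˡ pre {x ∷ post} (subst Unique eq₁ uniq₁))
                  disjoint)
    connected : MaybeConnected R (last (reverse Q)) (head P)
    connected = subst₂ (MaybeConnected R)
      (trans (cong head eq₂) (trans (head-++-∷ pre₂) (sym (last-reverse Q))))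
      (trans (cong head eq₁) (head-++-∷ pre))
      (just (R-sym Ruv))
    linked : Linked R (x ∷ (reverse pre₂ ++ pre) ++ [ x ])
    linked = subst (Linked R)
      (trans (sym (++-assoc (reverse Q) pre [ x ])) (cong (λ l → (l ++ pre) ++ [ x ]) reverse-Q))
      (Linked.++⁺ (Linked-reverse R-sym (Linked-++⁻ˡ Q (subst (Linked R) eq₂′ linked₂)))
                  connected
                  (Linked-++⁻ˡ P (subst (Linked R) eq₁′ linked₁)))

-- Rooted trees

record RootedTree {n} (G : Graph n) : Set where
  field
    root         : Fin n
    parent       : Fin n → Fin n
    depth        : Fin n → ℕ
    parent-adj   : ∀ {v} → v ≢ root → Adj G (parent v) v
    depth-parent : ∀ {v} → v ≢ root → depth v ≡ suc (depth (parent v))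
    edge-parent  : ∀ {u v} → Adj G u v → (v ≢ root × parent v ≡ u) ⊎ (u ≢ root × parent u ≡ v)

least-witness : {P : Pred ℕ p} → Decidable P → ∀ {b} → P b → ∃ λ k → P k × (∀ {j} → j < k → ¬ P j)
least-witness P? {zero} p₀ = 0 , p₀ , λ ()
least-witness P? {suc b} pb with P? 0
... | yes p₀ = 0 , p₀ , λ ()
... | no ¬p₀ with k , pk , below-k ← least-witness (P? ∘ suc) pb =
  suc k , pk , λ { {zero} _ → ¬p₀ ; {suc j} j<k → below-k (≤-pred j<k) }

module BreadthFirst {n} (G : Graph n) (r : Fin n) (connected : Connected G) where

  Reach : ℕ → Fin n → Set
  Reach zero    v = v ≡ r
  Reach (suc k) v = Reach k v ⊎ ∃ λ u → Reach k u × Adj G u v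

  reach? : ∀ k v → Dec (Reach k v)
  reach? zero    v = v ≟ r
  reach? (suc k) v = reach? k v ⊎-dec any? (λ u → reach? k u ×-dec adj? G u v)

  walk-length : ∀ {u v} → Walk G u v → ℕ
  walk-length nil        = 0
  walk-length (cons _ w) = suc (walk-length w)

  reach-walk : ∀ {v} (w : Walk G v r) → Reach (walk-length w) v
  reach-walk nil         = refl
  reach-walk (cons vw w) = inj₂ (_ , reach-walk w , Adj-sym G vw)

  depth-witness : ∀ v → ∃ λ k → Reach k v × (∀ {j} → j < k → ¬ Reach j v)
  depth-witness v = least-witness (λ k → reach? k v) (reach-walk (connected v r))

  depth : Fin n → ℕ
  depth v = proj₁ (depth-witness v)

  reach-depth : ∀ v → Reach (depth v) v
  reach-depth v = proj₁ (proj₂ (depth-witness v))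

  depth-minimal : ∀ {v j} → j < depth v → ¬ Reach j v
  depth-minimal {v} = proj₂ (proj₂ (depth-witness v))

  depth-least : ∀ {v k} → Reach k v → depth v ≤ k
  depth-least reach = ≮⇒≥ (λ k<d → depth-minimal k<d reach)

  depth≡0⇒root : ∀ {v} → depth v ≡ 0 → v ≡ r
  depth≡0⇒root {v} d≡0 = subst (λ k → Reach k v) d≡0 (reach-depth v)

  suc-depth⇒≢root : ∀ {v k} → depth v ≡ suc k → v ≢ r
  suc-depth⇒≢root d≡1+k refl = 1+n≢0 (trans (sym d≡1+k) (n≤0⇒n≡0 (depth-least refl)))

  parentage : ∀ v → v ≡ r ⊎ ∃ λ u → Adj G u v × depth v ≡ suc (depth u)
  parentage v = from-reach (depth v) refl (reach-depth v)
    where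
    from-reach : ∀ k → depth v ≡ k → Reach k v → v ≡ r ⊎ ∃ λ u → Adj G u v × depth v ≡ suc (depth u)
    from-reach zero    _     v≡r              = inj₁ v≡r
    from-reach (suc k) d≡1+k (inj₁ reachₖ)    = contradiction reachₖ (depth-minimal (≤-reflexive (sym d≡1+k)))
    from-reach (suc k) d≡1+k (inj₂ (u , reachₖ , uv)) = inj₂ (u , uv , ≤-antisym
      (depth-least (inj₂ (u , reach-depth u , uv)))
      (subst (suc (depth u) ≤_) (sym d≡1+k) (s≤s (depth-least reachₖ))))

  parent : Fin n → Fin n
  parent v = [ (λ _ → r) , proj₁ ]′ (parentage v)

  parent-spec : ∀ {v} → v ≢ r → Adj G (parent v) v × depth v ≡ suc (depth (parent v))
  parent-spec {v} v≢r = from-parentage (parentage v)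
    where
    from-parentage : (p : v ≡ r ⊎ ∃ λ u → Adj G u v × depth v ≡ suc (depth u)) →
                     let u = [ (λ _ → r) , proj₁ ]′ p in Adj G u v × depth v ≡ suc (depth u)
    from-parentage (inj₁ v≡r)           = contradiction v≡r v≢r
    from-parentage (inj₂ (_ , uv , d≡)) = uv , d≡

  parent-depth : ∀ {v k} → depth v ≡ suc k → depth (parent v) ≡ k
  parent-depth d≡1+k = suc-injective (trans (sym (proj₂ (parent-spec (suc-depth⇒≢root d≡1+k)))) d≡1+k)

  properAncestors : ℕ → Fin n → List (Fin n)
  properAncestors zero    v = []
  properAncestors (suc k) v = parent v ∷ properAncestors k (parent v)

  ancestors-linked : ∀ k {v} → depth v ≡ k → Linked (Adj G) (v ∷ properAncestors k v)
  ancestors-linked zero    _     = [-]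
  ancestors-linked (suc k) d≡1+k =
    Adj-sym G (proj₁ (parent-spec (suc-depth⇒≢root d≡1+k))) ∷ ancestors-linked k (parent-depth d≡1+k)

  properAncestors-depth : ∀ k {v x} → depth v ≡ k → x ∈ₗ properAncestors k v → depth x < k
  properAncestors-depth (suc k) d≡1+k (here refl) = ≤-reflexive (cong suc (parent-depth d≡1+k))
  properAncestors-depth (suc k) d≡1+k (there x∈) =
    m<n⇒m<1+n (properAncestors-depth k (parent-depth d≡1+k) x∈)

  ancestors-unique : ∀ k {v} → depth v ≡ k → Unique (v ∷ properAncestors k v)
  ancestors-unique zero    _           = All.[] ∷ []
  ancestors-unique (suc k) {v} d≡1+k = All.tabulate v∉ ∷ ancestors-unique k (parent-depth d≡1+k)
    where
    v∉ : ∀ {x} → x ∈ₗ properAncestors (suc k) v → v ≢ x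
    v∉ x∈ refl = <-irrefl d≡1+k (properAncestors-depth (suc k) d≡1+k x∈)

  root∈ancestors : ∀ k {v} → depth v ≡ k → r ∈ₗ v ∷ properAncestors k v
  root∈ancestors zero    d≡0   = here (sym (depth≡0⇒root d≡0))
  root∈ancestors (suc k) d≡1+k = there (root∈ancestors k (parent-depth d≡1+k))

  head-properAncestors : ∀ k {v w} → depth v ≡ k → head (properAncestors k v) ≡ just w →
                         v ≢ r × parent v ≡ w
  head-properAncestors (suc k) d≡1+k refl = suc-depth⇒≢root d≡1+k , refl

  edge-parent : ¬ HasCycle G → ∀ {u v} → Adj G u v → (v ≢ r × parent v ≡ u) ⊎ (u ≢ r × parent u ≡ v)
  edge-parent acyclic {u} {v} uv with ¬? (v ≟ r) ×-dec (parent v ≟ u) | ¬? (u ≟ r) ×-dec (parent u ≟ v)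
  ... | yes v↑u | _       = inj₁ v↑u
  ... | no _    | yes u↑v = inj₂ u↑v
  ... | no ¬v↑u | no ¬u↑v = contradiction
    (cycle-through-edge _≟_ (Adj-sym G)
      (ancestors-unique (depth u) refl) (ancestors-unique (depth v) refl)
      (ancestors-linked (depth u) refl) (ancestors-linked (depth v) refl)
      uv (Adj⇒≢ G uv)
      (¬u↑v ∘ head-properAncestors (depth u) refl) (¬v↑u ∘ head-properAncestors (depth v) refl)
      (root∈ancestors (depth u) refl) (root∈ancestors (depth v) refl))
    acyclic

rootedTree : ∀ {n} {G : Graph n} → IsTree G → RootedTree G
rootedTree {n} {G} (0<n , connected , acyclic) = record
  { root         = root
  ; parent       = parent
  ; depth        = depth
  ; parent-adj   = proj₁ ∘ parent-spec
  ; depth-parent = proj₂ ∘ parent-spec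
  ; edge-parent  = edge-parent acyclic
  }
  where
  root : Fin n
  root = fromℕ< 0<n
  open BreadthFirst G root connected

-- Splitting the removable vertices of a dominating set of a tree

not-swap : ∀ {x y} → x ≡ not y → y ≡ not x
not-swap {y = y} x≡¬y = trans (sym (not-involutive y)) (cong not (sym x≡¬y))

module RemovableSplit {n} {G : Graph n} (T : RootedTree G) {S : Subset n} (dom : Dominating G S) where

  open RootedTree T

  ParentInS : Fin n → Set
  ParentInS v = v ≢ root × parent v ∈ S

  parentInS? : ∀ v → Dec (ParentInS v)
  parentInS? v = ¬? (v ≟ root) ×-dec (parent v ∈? S)

  Exposed : Fin n → Set
  Exposed w = w ∉ S × ¬ ParentInS w

  designated : Fin n → Fin n
  designated w with any? (λ u → (u ∈? S) ×-dec adj? G w u)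
  ... | yes (u , _) = u
  ... | no _        = w

  designated-spec : ∀ {w u} → u ∈ S → Adj G w u → designated w ∈ S × Adj G w (designated w)
  designated-spec {w} u∈S wu with any? (λ u → (u ∈? S) ×-dec adj? G w u)
  ... | yes (_ , spec) = spec
  ... | no none        = contradiction (_ , u∈S , wu) none

  Secondary : Fin n → Set
  Secondary a = a ≢ root × Exposed (parent a) × a ≢ designated (parent a)

  secondary? : ∀ a → Dec (Secondary a)
  secondary? a = ¬? (a ≟ root)
           ×-dec ((¬? (parent a ∈? S) ×-dec ¬? (parentInS? (parent a))) ×-dec ¬? (a ≟ designated (parent a)))

  Flips : Fin n → Set
  Flips a = Removable G S a × ¬ Secondary a

  flips? : ∀ a → Dec (Flips a)
  flips? a = removable? G S a ×-dec ¬? (secondary? a)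

  -- A removable vertex is coloured opposite to its parent unless it is a secondary child of an
  -- exposed vertex w; those share w's colour, while the designated child of w, if removable,
  -- gets the other one. So w keeps a dominator in S whichever colour class is deleted.
  colourAt : ℕ → Fin n → Bool
  colourAt zero    v = false
  colourAt (suc k) v = does (flips? v) xor colourAt k (parent v)

  colour : Fin n → Bool
  colour v = colourAt (depth v) v

  colour-parent : ∀ {v} → v ≢ root → colour v ≡ does (flips? v) xor colour (parent v)
  colour-parent {v} v≢root = cong (λ k → colourAt k v) (depth-parent v≢root)

  colour-flip : ∀ {v} → v ≢ root → Flips v → colour v ≡ not (colour (parent v))
  colour-flip {v} v≢root flips =
    trans (colour-parent v≢root) (cong (_xor colour (parent v)) (dec-true (flips? v) flips))

  colour-keep : ∀ {v} → v ≢ root → ¬ Flips v → colour v ≡ colour (parent v)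
  colour-keep {v} v≢root ¬flips =
    trans (colour-parent v≢root) (cong (_xor colour (parent v)) (dec-false (flips? v) ¬flips))

  ∉S⇒¬Flips : ∀ {w} → w ∉ S → ¬ Flips w
  ∉S⇒¬Flips w∉S ((w∈S , _) , _) = w∉S w∈S

  Discarded : Bool → Fin n → Set
  Discarded b v = Removable G S v × colour v ≡ b

  discarded? : ∀ b v → Dec (Discarded b v)
  discarded? b v = removable? G S v ×-dec (colour v ≟ᵇ b)

  Kept : Bool → Fin n → Set
  Kept b v = v ∈ S × ¬ Discarded b v

  kept? : ∀ b v → Dec (Kept b v)
  kept? b v = (v ∈? S) ×-dec ¬? (discarded? b v)

  opposite⇒kept : ∀ {b u} → u ∈ S → (Removable G S u → colour u ≡ not b) → Kept b u
  opposite⇒kept u∈S opposite = u∈S , λ (removable , u≡b) → not-¬ u≡b (opposite removable)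

  kept-dominates-∈S : ∀ b {w} → w ∈ S → Kept b w ⊎ ∃ λ u → Kept b u × Adj G u w
  kept-dominates-∈S b {w} w∈S with discarded? b w
  ... | no ¬discarded = inj₁ (w∈S , ¬discarded)
  ... | yes (removable , w≡b) with parentInS? w
  ...   | yes (w≢root , p∈S) = inj₂ (parent w , opposite⇒kept p∈S (λ _ → p≡¬b) , parent-adj w≢root)
    where
    p≡¬b : colour (parent w) ≡ not b
    p≡¬b = not-swap (trans (sym w≡b) (colour-flip w≢root (removable , λ (_ , (p∉S , _) , _) → p∉S p∈S)))
  ...   | no ¬parent∈S with removable-dominated G removable w
  ...     | inj₁ (_ , w≢w)          = contradiction refl w≢w
  ...     | inj₂ (u , u∈S , _ , uw) with edge-parent uw
  ...       | inj₁ (w≢root , pw≡u) = contradiction (w≢root , subst (_∈ S) (sym pw≡u) u∈S) ¬parent∈S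
  ...       | inj₂ (u≢root , pu≡w) = inj₂ (u , opposite⇒kept u∈S flipped , uw)
    where
    flipped : Removable G S u → colour u ≡ not b
    flipped removableᵤ =
      trans (colour-flip u≢root (removableᵤ , λ (_ , (pu∉S , _) , _) → pu∉S (subst (_∈ S) (sym pu≡w) w∈S)))
            (cong not (trans (cong colour pu≡w) w≡b))

  kept-dominates-parentInS : ∀ b {w} → w ∉ S → ParentInS w → ∃ λ u → Kept b u × Adj G u w
  kept-dominates-parentInS b {w} w∉S parent∈S@(w≢root , p∈S) with discarded? b (parent w)
  ... | no ¬discarded = parent w , (p∈S , ¬discarded) , parent-adj w≢root
  ... | yes (removableₚ , p≡b) with removable-dominated G removableₚ w
  ...   | inj₁ (w∈S , _)            = contradiction w∈S w∉S
  ...   | inj₂ (u , u∈S , u≢p , uw) with edge-parent uw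
  ...     | inj₁ (_ , pw≡u)      = contradiction (sym pw≡u) u≢p
  ...     | inj₂ (u≢root , pu≡w) = u , opposite⇒kept u∈S flipped , uw
    where
    w≡b : colour w ≡ b
    w≡b = trans (colour-keep w≢root (∉S⇒¬Flips w∉S)) p≡b
    flipped : Removable G S u → colour u ≡ not b
    flipped removableᵤ =
      trans (colour-flip u≢root (removableᵤ , λ (_ , (_ , ¬parent∈S) , _) →
                                                ¬parent∈S (subst ParentInS (sym pu≡w) parent∈S)))
            (cong not (trans (cong colour pu≡w) w≡b))

  kept-dominates-exposed : ∀ b {w} → Exposed w → ∃ λ u → Kept b u × Adj G u w
  kept-dominates-exposed b {w} (w∉S , ¬parent∈S) with dom w
  ... | inj₁ w∈S = contradiction w∈S w∉S
  ... | inj₂ (u₀ , u₀∈S , u₀w) with designated-spec u₀∈S (Adj-sym G u₀w)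
  ...   | c∈S , wc with edge-parent (Adj-sym G wc)
  ...     | inj₁ (w≢root , pw≡c) = contradiction (w≢root , subst (_∈ S) (sym pw≡c) c∈S) ¬parent∈S
  ...     | inj₂ (c≢root , pc≡w) with discarded? b (designated w)
  ...       | no ¬discarded = designated w , (c∈S , ¬discarded) , Adj-sym G wc
  ...       | yes (removableᶜ , c≡b) with removable-dominated G removableᶜ w
  ...         | inj₁ (w∈S , _)            = contradiction w∈S w∉S
  ...         | inj₂ (u , u∈S , u≢c , uw) with edge-parent uw
  ...           | inj₁ (w≢root , pw≡u) = contradiction (w≢root , subst (_∈ S) (sym pw≡u) u∈S) ¬parent∈S
  ...           | inj₂ (u≢root , pu≡w) = u , opposite⇒kept u∈S same-as-w , uw
    where
    c-designated : designated w ≡ designated (parent (designated w))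
    c-designated = cong designated (sym pc≡w)
    w≡¬b : colour w ≡ not b
    w≡¬b = not-swap (trans (sym c≡b) (trans (colour-flip c≢root (removableᶜ , λ (_ , _ , c≢c) → c≢c c-designated))
                                             (cong (not ∘ colour) pc≡w)))
    secondary : Secondary u
    secondary = u≢root , subst Exposed (sym pu≡w) (w∉S , ¬parent∈S) ,
                λ u≡c → u≢c (trans u≡c (cong designated pu≡w))
    same-as-w : Removable G S u → colour u ≡ not b
    same-as-w _ = trans (colour-keep u≢root (λ (_ , ¬secondary) → ¬secondary secondary))
                        (trans (cong colour pu≡w) w≡¬b)

  kept-dominates : ∀ b w → Kept b w ⊎ ∃ λ u → Kept b u × Adj G u w
  kept-dominates b w with w ∈? S | parentInS? w
  ... | yes w∈S | _            = kept-dominates-∈S b w∈S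
  ... | no w∉S  | yes parent∈S = inj₂ (kept-dominates-parentInS b w∉S parent∈S)
  ... | no w∉S  | no ¬parent∈S = inj₂ (kept-dominates-exposed b (w∉S , ¬parent∈S))

  kept : Bool → Subset n
  kept b = subsetOf (kept? b)

  kept-dominating : ∀ b → Dominating G (kept b)
  kept-dominating b w = Sum.map (∈-subsetOf⁺ (kept? b))
                                (λ (u , kept-u , uw) → u , ∈-subsetOf⁺ (kept? b) kept-u , uw)
                                (kept-dominates b w)

  removableCount-split : removableCount G S ≡ count (discarded? true) + count (discarded? false)
  removableCount-split = trans (count-split (removable? G S) (λ v → colour v ≟ᵇ true))
    (cong (count (discarded? true) +_)
          (count-cong (removable? G S ∩? ∁? (λ v → colour v ≟ᵇ true)) (discarded? false)
                      (λ (removable , c≢true) → removable , ¬-not c≢true)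
                      (λ (removable , c≡false) → removable , not-¬ c≡false)))

  ∣S∣-split : ∀ b → count (discarded? b) + ∣ kept b ∣ ≡ ∣ S ∣
  ∣S∣-split b = begin
    count (discarded? b) + ∣ kept b ∣                  ≡⟨ cong (count (discarded? b) +_) (∣subsetOf∣ (kept? b)) ⟩
    count (discarded? b) + count (kept? b)             ≡⟨ cong (_+ count (kept? b)) discarded-in-S ⟨
    count ((_∈? S) ∩? discarded? b) + count (kept? b)  ≡⟨ count-split (_∈? S) (discarded? b) ⟨
    count (_∈? S)                                      ≡⟨ ∣p∣≡count-∈ S ⟨
    ∣ S ∣                                              ∎
    where
    open ≡-Reasoning
    discarded-in-S : count ((_∈? S) ∩? discarded? b) ≡ count (discarded? b)
    discarded-in-S = count-cong ((_∈? S) ∩? discarded? b) (discarded? b) proj₂ (λ d@((v∈S , _) , _) → v∈S , d)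

removableCount-lower : ∀ {n} {G : Graph n} → RootedTree G → ∀ {γ} → IsDominationNumber G γ →
                       ∀ S → Dominating G S → removableCount G S + 2 * γ ≤ 2 * ∣ S ∣
removableCount-lower T (_ , minimum) S dom =
  arithmetic (∣S∣-split true) (∣S∣-split false) removableCount-split
             (minimum (kept true) (kept-dominating true)) (minimum (kept false) (kept-dominating false))
  where
  open RemovableSplit T dom
  arithmetic : ∀ {s r x y k l g} → x + k ≡ s → y + l ≡ s → r ≡ x + y → g ≤ k → g ≤ l → r + 2 * g ≤ 2 * s
  arithmetic {s} {r} {x} {y} {k} {l} {g} x+k≡s y+l≡s r≡x+y g≤k g≤l = begin
    r + 2 * g          ≡⟨ cong (_+ 2 * g) r≡x+y ⟩
    x + y + 2 * g      ≡⟨ solve 3 (λ x y g → x :+ y :+ con 2 :* g := (x :+ g) :+ (y :+ g)) refl x y g ⟩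
    (x + g) + (y + g)  ≤⟨ +-mono-≤ (+-monoʳ-≤ x g≤k) (+-monoʳ-≤ y g≤l) ⟩
    (x + k) + (y + l)  ≡⟨ cong₂ _+_ x+k≡s y+l≡s ⟩
    s + s              ≡⟨ solve 1 (λ s → s :+ s := con 2 :* s) refl s ⟩
    2 * s              ∎
    where open ≤-Reasoning

-- Independent sets built from a dominating set of a tree

parity : ℕ → Bool
parity zero    = true
parity (suc k) = not (parity k)

module IsolatedLayers {n} {G : Graph n} (T : RootedTree G) {S : Subset n} (dom : Dominating G S) where

  open RootedTree T

  Isolated : Fin n → Set
  Isolated v = v ∈ S × ∀ u → ¬ (u ∈ S × Adj G u v)

  isolated? : ∀ v → Dec (Isolated v)
  isolated? v = (v ∈? S) ×-dec all? (λ u → ¬? ((u ∈? S) ×-dec adj? G u v))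

  NextToIsolated : Fin n → Set
  NextToIsolated w = ∃ λ p → Isolated p × Adj G p w

  Remote : Fin n → Set
  Remote w = ¬ Isolated w × ¬ NextToIsolated w

  remote? : ∀ w → Dec (Remote w)
  remote? w = ¬? (isolated? w) ×-dec ¬? (any? (λ p → isolated? p ×-dec adj? G p w))

  Layer : Bool → Fin n → Set
  Layer b w = Remote w × parity (depth w) ≡ b

  layer? : ∀ b w → Dec (Layer b w)
  layer? b w = remote? w ×-dec (parity (depth w) ≟ᵇ b)

  adjacent-parity : ∀ {u v} → Adj G u v → parity (depth u) ≢ parity (depth v)
  adjacent-parity uv with edge-parent uv
  ... | inj₁ (v≢root , refl) = λ eq → not-¬ refl (trans eq (cong parity (depth-parent v≢root)))
  ... | inj₂ (u≢root , refl) = λ eq → not-¬ refl (trans (sym eq) (cong parity (depth-parent u≢root)))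

  isolatedOrLayer? : ∀ b v → Dec (Isolated v ⊎ Layer b v)
  isolatedOrLayer? b = isolated? ∪? layer? b

  isolatedOrLayer-independent : ∀ b → Independent G (subsetOf (isolatedOrLayer? b))
  isolatedOrLayer-independent b u∈ v∈ =
    separated (∈-subsetOf⁻ (isolatedOrLayer? b) u∈) (∈-subsetOf⁻ (isolatedOrLayer? b) v∈)
    where
    separated : ∀ {u v} → Isolated u ⊎ Layer b u → Isolated v ⊎ Layer b v → ¬ Adj G u v
    separated (inj₁ (u∈S , _))       (inj₁ (_ , isolatedᵥ))    uv = isolatedᵥ _ (u∈S , uv)
    separated (inj₁ isolatedᵤ)       (inj₂ ((_ , far) , _))    uv = far (_ , isolatedᵤ , uv)
    separated (inj₂ ((_ , far) , _)) (inj₁ isolatedᵥ)          uv = far (_ , isolatedᵥ , Adj-sym G uv)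
    separated (inj₂ (_ , u≡b))       (inj₂ (_ , v≡b))          uv = adjacent-parity uv (trans u≡b (sym v≡b))

  isolated+layer≤Γ : ∀ {Γ} → IsUpperDominationNumber G Γ → ∀ b → count isolated? + count (layer? b) ≤ Γ
  isolated+layer≤Γ (_ , maximum) b
    with M , I⊆M , minimal ← independent⇒⊆minimalDominating G (isolatedOrLayer-independent b) = begin
    count isolated? + count (layer? b)  ≡⟨ count-∪ isolated? (layer? b) (λ isolated ((¬isolated , _) , _) →
                                                                           ¬isolated isolated) ⟨
    count (isolatedOrLayer? b)          ≡⟨ ∣subsetOf∣ (isolatedOrLayer? b) ⟨
    ∣ subsetOf (isolatedOrLayer? b) ∣   ≤⟨ p⊆q⇒∣p∣≤∣q∣ I⊆M ⟩
    ∣ M ∣                               ≤⟨ maximum M minimal ⟩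
    _                                   ∎
    where open ≤-Reasoning

  Active : Fin n → Set
  Active p = p ∈ S × ¬ Isolated p

  active? : ∀ p → Dec (Active p)
  active? = (_∈? S) ∩? ∁? isolated?

  Essential : Fin n → Set
  Essential p = Active p × ¬ Removable G S p

  essential? : ∀ p → Dec (Essential p)
  essential? = active? ∩? ∁? (removable? G S)

  PrivateNeighbour : Fin n → Fin n → Set
  PrivateNeighbour p w = w ∉ S × Adj G p w × (∀ u → u ∈ S → Adj G u w → u ≡ p)

  privateNeighbour? : ∀ p w → Dec (PrivateNeighbour p w)
  privateNeighbour? p w =
    ¬? (w ∈? S) ×-dec adj? G p w ×-dec all? (λ u → (u ∈? S) →-dec (adj? G u w →-dec (u ≟ p)))

  active⇒S-neighbour : ∀ {p} → Active p → ∃ λ u → u ∈ S × Adj G u p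
  active⇒S-neighbour {p} (p∈S , ¬isolated) with any? (λ u → (u ∈? S) ×-dec adj? G u p)
  ... | yes neighbour = neighbour
  ... | no none       = contradiction (p∈S , λ u u∈S×up → none (u , u∈S×up)) ¬isolated

  removable⇒active : ∀ {v} → Removable G S v → Active v
  removable⇒active {v} removable@(v∈S , _) with removable-dominated G removable v
  ... | inj₁ (_ , v≢v)          = contradiction refl v≢v
  ... | inj₂ (u , u∈S , _ , uv) = v∈S , λ (_ , isolated) → isolated u (u∈S , uv)

  essential⇒privateNeighbour : ∀ {p} → Essential p → ∃ (PrivateNeighbour p)
  essential⇒privateNeighbour {p} (active@(p∈S , _) , ¬removable)
    with w , undominated ← ¬∀⟶∃¬ n (Dominated G (S - p)) (dominated? G (S - p)) (¬removable ∘ (p∈S ,_)) =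
    w , w∉S , adjacent (dom w) , only-p
    where
    only-p : ∀ u → u ∈ S → Adj G u w → u ≡ p
    only-p u u∈S uw with u ≟ p
    ... | yes u≡p = u≡p
    ... | no u≢p  = contradiction (inj₂ (u , x∈p∧x≢y⇒x∈p-y u∈S u≢p , uw)) undominated
    w∉S : w ∉ S
    w∉S w∈S with w ≟ p | active⇒S-neighbour active
    ... | no w≢p   | _            = undominated (inj₁ (x∈p∧x≢y⇒x∈p-y w∈S w≢p))
    ... | yes refl | u , u∈S , up = undominated (inj₂ (u , x∈p∧x≢y⇒x∈p-y u∈S (Adj⇒≢ G up) , up))
    adjacent : Dominated G S w → Adj G p w
    adjacent (inj₁ w∈S)            = contradiction w∈S w∉S
    adjacent (inj₂ (u , u∈S , uw)) = subst (λ u → Adj G u w) (only-p u u∈S uw) uw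

  privateNeighbour-remote : ∀ {p w} → Essential p × PrivateNeighbour p w → Remote w × w ∉ S
  privateNeighbour-remote (((_ , ¬isolated) , _) , w∉S , _ , only-p) =
    (w∉S ∘ proj₁ , λ (q , isolated@(q∈S , _) , qw) → ¬isolated (subst Isolated (only-p q q∈S qw) isolated)) , w∉S

  essential≤remote-outside : count essential? ≤ count (remote? ∩? ∁? (_∈? S))
  essential≤remote-outside =
    count-≤-matching essential? (remote? ∩? ∁? (_∈? S)) (λ p w → essential? p ×-dec privateNeighbour? p w)
      (λ essential → let w , private-w = essential⇒privateNeighbour essential in w , essential , private-w)
      privateNeighbour-remote
      (λ (((p∈S , _) , _) , _ , pw , _) (_ , _ , _ , only-p′) → only-p′ _ p∈S pw)

  ∣S∣-split : ∣ S ∣ ≡ count isolated? + count active?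
  ∣S∣-split = trans (∣p∣≡count-∈ S) (trans (count-split (_∈? S) isolated?)
    (cong (_+ count active?) (count-cong ((_∈? S) ∩? isolated?) isolated? proj₂ (λ i → proj₁ i , i))))

  active-split : count active? ≡ removableCount G S + count essential?
  active-split = trans (count-split active? (removable? G S))
    (cong (_+ count essential?) (count-cong (active? ∩? removable? G S) (removable? G S)
                                            proj₂ (λ r → removable⇒active r , r)))

  remote-split : count remote? ≡ count active? + count (remote? ∩? ∁? (_∈? S))
  remote-split = trans (count-split remote? (_∈? S))
    (cong (_+ count (remote? ∩? ∁? (_∈? S))) (count-cong (remote? ∩? (_∈? S)) active? remote⇒active active⇒remote))
    where
    remote⇒active : ∀ {v} → Remote v × v ∈ S → Active v
    remote⇒active ((¬isolated , _) , v∈S) = v∈S , ¬isolated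
    active⇒remote : ∀ {v} → Active v → Remote v × v ∈ S
    active⇒remote (v∈S , ¬isolated) =
      (¬isolated , λ (_ , (_ , isolated) , pv) → isolated _ (v∈S , Adj-sym G pv)) , v∈S

  layer-split : count remote? ≡ count (layer? true) + count (layer? false)
  layer-split = trans (count-split remote? (λ w → parity (depth w) ≟ᵇ true))
    (cong (count (layer? true) +_) (count-cong (remote? ∩? ∁? (λ w → parity (depth w) ≟ᵇ true)) (layer? false)
                                               (λ (remote , ≢true) → remote , ¬-not ≢true)
                                               (λ (remote , ≡false) → remote , not-¬ ≡false)))

removableCount-upper : ∀ {n} {G : Graph n} → RootedTree G → ∀ {Γ} → IsUpperDominationNumber G Γ →
                       ∀ S → Dominating G S → 2 * ∣ S ∣ ≤ removableCount G S + 2 * Γ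
removableCount-upper T isΓ S dom =
  arithmetic ∣S∣-split active-split remote-split essential≤remote-outside layer-split
             (isolated+layer≤Γ isΓ true) (isolated+layer≤Γ isΓ false)
  where
  open IsolatedLayers T dom
  arithmetic : ∀ {s l a r p q y z₁ z₂ g} → s ≡ l + a → a ≡ r + p → y ≡ a + q → p ≤ q → y ≡ z₁ + z₂ →
               l + z₁ ≤ g → l + z₂ ≤ g → 2 * s ≤ r + 2 * g
  arithmetic {s} {l} {a} {r} {p} {q} {y} {z₁} {z₂} {g} s≡l+a a≡r+p y≡a+q p≤q y≡z₁+z₂ l+z₁≤g l+z₂≤g = begin
    2 * s                      ≡⟨ cong (2 *_) s≡l+a ⟩
    2 * (l + a)                ≡⟨ solve 2 (λ l a → con 2 :* (l :+ a) := (l :+ l) :+ a :+ a) refl l a ⟩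
    (l + l) + a + a            ≡⟨ cong ((l + l) + a +_) a≡r+p ⟩
    (l + l) + a + (r + p)      ≤⟨ +-monoʳ-≤ ((l + l) + a) (+-monoʳ-≤ r p≤q) ⟩
    (l + l) + a + (r + q)      ≡⟨ solve 4 (λ l a r q → (l :+ l) :+ a :+ (r :+ q) := r :+ ((l :+ l) :+ (a :+ q)))
                                        refl l a r q ⟩
    r + ((l + l) + (a + q))    ≡⟨ cong (λ t → r + ((l + l) + t)) (trans (sym y≡a+q) y≡z₁+z₂) ⟩
    r + ((l + l) + (z₁ + z₂))  ≡⟨ solve 4 (λ r l z₁ z₂ → r :+ ((l :+ l) :+ (z₁ :+ z₂))
                                                      := r :+ ((l :+ z₁) :+ (l :+ z₂))) refl r l z₁ z₂ ⟩
    r + ((l + z₁) + (l + z₂))  ≤⟨ +-monoʳ-≤ r (+-mono-≤ l+z₁≤g l+z₂≤g) ⟩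
    r + (g + g)                ≡⟨ cong (r +_) (solve 1 (λ g → g :+ g := con 2 :* g) refl g) ⟩
    r + 2 * g                  ∎
    where open ≤-Reasoning

corollary17 : (n : ℕ) (T : Graph n) → IsTree T →
              (γ Γ : ℕ) → IsDominationNumber T γ → IsUpperDominationNumber T Γ →
              Γ < γ + 3 →
              Unimodal (domCount T) n
corollary17 n T tree γ Γ isγ isΓ Γ<γ+3 =
  unimodal-from-removal-bounds (domCount T) n γ Γ Γ≤γ+2
    (domCount-lower T (2 * γ) (removableCount-lower rooted isγ))
    (domCount-upper T (2 * Γ) (removableCount-upper rooted isΓ))
  where
  rooted : RootedTree T
  rooted = rootedTree tree
  Γ≤γ+2 : Γ ≤ γ + 2
  Γ≤γ+2 = ≤-pred (subst (Γ <_) (+-suc γ 2) Γ<γ+3)
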